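{- Let $\mathbf a=(a_1,\dots,a_n)$ be a circular area sequence such that either $a_i\ge n/2$ for all $i$, or $\max_i a_i=n-1$. Then $\mathrm X_{\mathbf a}(\mathbf x;q)=C^{\mathbf a}(q)\,\mathrm e_{(n)}(\mathbf x)$ for some polynomial $C^{\mathbf a}(q)$ with non-negative integer coefficients.
   Context: A circular area sequence is an integer sequence $\mathbf a=(a_1,\dots,a_n)$ with $0\le a_i\le n-1$ and $a_i-1\le a_{i+1}$ for all $i$, indices mod $n$. $\Gamma_{\mathbf a}$ is the directed graph on $[n]$ with edges $i\to i+1,\dots,i\to i+a_i$ (labels mod $n$). $\mathrm X_{\mathbf a}(\mathbf x;q)=\sum_F\mathbf x^Fq^{\mathrm{asc}_{\mathbf a}(F)}$ over maps $F:[n]\to\mathbb Z_{>0}$ with $F(i)\neq F(j)$ for every edge $i\to j$, where $\mathbf x^F=\prod_vx_{F(v)}$ and $\mathrm{asc}_{\mathbf a}(F)$ counts edges $i\to j$ with $F(i)<F(j)$. $\mathrm e_{(n)}$ is the $n$-th elementary symmetric function. -}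

module Defs where

open import Data.Nat using (ℕ; zero; suc; _+_; _*_; _∸_; _≤_; _<_; NonZero; _≡ᵇ_; _≤ᵇ_)
open import Data.Nat.DivMod using (_mod_)
open import Data.Fin using (Fin; toℕ) renaming (zero to fzero; suc to fsuc)
import Data.Fin as F
open import Data.Bool using (Bool; true; false; if_then_else_; _∧_; not)
open import Data.List using (List; []; _∷_; map; concatMap; allFin; upTo)
open import Data.Nat.ListAction using (sum)
open import Data.Bool.ListAction using (all)
open import Data.Product using (_×_; _,_)
open import Relation.Nullary.Decidable using (⌊_⌋)

-- Cyclic index arithmetic on labels Fin n (labels 0..n-1 stand for 1..n).
shift : (n : ℕ) .{{_ : NonZero n}} → Fin n → ℕ → Fin n
shift n i d = (toℕ i + d) mod n

CircArea : (n : ℕ) .{{_ : NonZero n}} → (Fin n → ℕ) → Set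
CircArea n a = ∀ i → (a i < n) × (a i ≤ suc (a (shift n i 1)))

edges : (n : ℕ) .{{_ : NonZero n}} → (Fin n → ℕ) → List (Fin n × Fin n)
edges n a = concatMap (λ i → map (λ d → (i , shift n i (suc d))) (upTo (a i))) (allFin n)

countᵇ : {A : Set} → (A → Bool) → List A → ℕ
countᵇ p [] = 0
countᵇ p (x ∷ xs) = if p x then suc (countᵇ p xs) else countᵇ p xs

-- All maps Fin n → Fin m (colourings with colours 1..m, represented by Fin m).
consF : {n m : ℕ} → Fin m → (Fin n → Fin m) → Fin (suc n) → Fin m
consF c f fzero = c
consF c f (fsuc i) = f i

allFuns : (n m : ℕ) → List (Fin n → Fin m)
allFuns zero m = (λ ()) ∷ []
allFuns (suc n) m = concatMap (λ c → map (consF c) (allFuns n m)) (allFin m)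

proper : (n : ℕ) .{{_ : NonZero n}} → (Fin n → ℕ) → {m : ℕ} → (Fin n → Fin m) → Bool
proper n a f = all (λ { (i , j) → not ⌊ f i F.≟ f j ⌋ }) (edges n a)

asc : (n : ℕ) .{{_ : NonZero n}} → (Fin n → ℕ) → {m : ℕ} → (Fin n → Fin m) → ℕ
asc n a f = countᵇ (λ { (i , j) → ⌊ f i F.<? f j ⌋ }) (edges n a)

-- x^F = x^α, i.e. colour c is used exactly α c times.
hasContent : (n : ℕ) {m : ℕ} → (Fin n → Fin m) → (Fin m → ℕ) → Bool
hasContent n {m} f α = all (λ c → countᵇ (λ i → ⌊ f i F.≟ c ⌋) (allFin n) ≡ᵇ α c) (allFin m)

-- Coefficient of x_1^{α_1}⋯x_m^{α_m} q^k in X_a(x;q).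
coeffX : (n : ℕ) .{{_ : NonZero n}} → (Fin n → ℕ) → (m : ℕ) → (Fin m → ℕ) → ℕ → ℕ
coeffX n a m α k = countᵇ (λ f → proper n a f ∧ hasContent n f α ∧ (asc n a f ≡ᵇ k)) (allFuns n m)

-- Coefficient of x_1^{α_1}⋯x_m^{α_m} in e_(n): 1 if α is 0/1-valued with sum n, else 0.
coeffE : (n m : ℕ) → (Fin m → ℕ) → ℕ
coeffE n m α = if all (λ c → α c ≤ᵇ 1) (allFin m) ∧ (sum (map α (allFin m)) ≡ᵇ n) then 1 else 0

-- Polynomials in q with ℕ coefficients as coefficient lists; coefficient of q^k.
coeff : List ℕ → ℕ → ℕ
coeff [] k = 0
coeff (c ∷ cs) zero = c
coeff (c ∷ cs) (suc k) = coeff cs k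

-- Under either hypothesis any two vertices of Γ_a are joined by an edge. If every a_i ≥ n/2,
-- the shorter of the two arcs between i and j has length at most a_i or a_j. If a_{i₀} = n - 1,
-- the area condition gives a_{i₀+k} ≥ n - 1 - k, so the vertex i₀+k points at every vertex i₀+l
-- with k < l < n. Hence proper colourings are injective: x^α q^k has a nonzero coefficient only
-- when α is 0/1-valued with |α| = n, i.e. when x^α is a monomial of e_(n). Composing colourings
-- with the increasing bijection from {1..n} onto the colours used preserves properness and
-- ascents, so all these coefficients equal the coefficient of x_1⋯x_n, which counts colourings.
module Submission where

open import Defs
open import Data.Bool using (Bool; true; false; T; not; _∧_; if_then_else_)
open import Data.Bool.ListAction using (all; and)
open import Data.Bool.Properties using (T-∧; ∧-commutativeMonoid)
open import Data.Empty using (⊥-elim)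
open import Data.Fin as F using (Fin; toℕ; punchIn) renaming (zero to fzero; suc to fsuc)
import Data.Fin.Properties as FP
open import Data.List
  using (List; []; _∷_; [_]; _++_; map; concatMap; allFin; tabulate; applyUpTo; upTo; length; foldr)
open import Data.List.Membership.Propositional using (_∈_)
open import Data.List.Membership.Propositional.Properties
  using (∈-allFin; ∈-map⁺; ∈-concat⁺′; ∈-upTo⁺)
open import Data.List.Properties using (map-tabulate; map-cong; length-map; length-tabulate)
open import Data.List.Relation.Unary.All as All using (All)
open import Data.List.Relation.Unary.All.Properties using (all⁺; all⁻)
open import Data.List.Relation.Unary.Any using (here; there)
open import Data.Nat
  using (ℕ; zero; suc; pred; _+_; _*_; _∸_; _≤_; _<_; z≤n; s≤s; NonZero; _≤?_; _≡ᵇ_; _≤ᵇ_)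
open import Data.Nat.DivMod using (_%_; %-distribˡ-+; m%n%n≡m%n; [m+n]%n≡m%n; m<n⇒m%n≡m; m%n<n)
open import Data.Nat.ListAction using (sum)
open import Data.Nat.Properties
open import Data.Product using (_×_; _,_; ∃; proj₂)
open import Data.Sum using (_⊎_; inj₁; inj₂; [_,_]′)
import Data.Vec.Functional as Vector
open import Function using (_∘_; id; _⇔_; mk⇔; Equivalence)
open import Relation.Binary using (tri<; tri≈; tri>)
open import Relation.Binary.PropositionalEquality
  using (_≡_; _≢_; _≗_; refl; sym; trans; cong; cong₂; subst; module ≡-Reasoning)
open import Relation.Nullary using (¬_; yes; no)
open import Relation.Nullary.Decidable
  using (Dec; ⌊_⌋; ⌊⌋-map′; isYes≗does; does-⇔; toWitness; fromWitness; toWitnessFalse)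
open import Algebra.Properties.CommutativeMonoid.Sum +-0-commutativeMonoid
  using (sum-syntax; sum-remove; sum-cong-≗; ∑-distrib-+; sum-replicate-zero)
open import Algebra.Properties.CommutativeMonoid.Sum ∧-commutativeMonoid
  using () renaming (sum to ⋀; sum-remove to ⋀-remove; sum-cong-≗ to ⋀-cong-≗)

foldr-map-allFin : ∀ {A : Set} (_∙_ : A → A → A) (ε : A) {m} (f : Fin m → A) →
  foldr _∙_ ε (map f (allFin m)) ≡ Vector.foldr _∙_ ε f
foldr-map-allFin {A} _∙_ ε f = trans (cong (foldr _∙_ ε) (map-tabulate id f)) (foldr-tabulate f)
  where
  foldr-tabulate : ∀ {m} (g : Fin m → A) → foldr _∙_ ε (tabulate g) ≡ Vector.foldr _∙_ ε g
  foldr-tabulate {zero} g = refl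
  foldr-tabulate {suc m} g = cong (g fzero ∙_) (foldr-tabulate (g ∘ fsuc))

⌊⌋-⇔ : {P Q : Set} → P ⇔ Q → (p? : Dec P) (q? : Dec Q) → ⌊ p? ⌋ ≡ ⌊ q? ⌋
⌊⌋-⇔ P⇔Q p? q? = trans (isYes≗does p?) (trans (does-⇔ P⇔Q p? q?) (sym (isYes≗does q?)))

T-all-allFin : ∀ {m} {p : Fin m → Bool} → T (all p (allFin m)) ⇔ (∀ c → T (p c))
T-all-allFin {m} {p} = mk⇔
  (λ t c → All.lookup (all⁺ p (allFin m) t) (∈-allFin c))
  (λ h → all⁻ p {allFin m} (All.tabulate (λ {c} _ → h c)))

punchIn-mono-< : ∀ {m} (j : Fin (suc m)) {x y : Fin m} → x F.< y → punchIn j x F.< punchIn j y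
punchIn-mono-< j {x} {y} x<y =
  FP.≤∧≢⇒< (FP.punchIn-mono-≤ j x y (<⇒≤ x<y)) (FP.<⇒≢ x<y ∘ FP.punchIn-injective j x y)

punchIn-cancel-< : ∀ {m} (j : Fin (suc m)) {x y : Fin m} → punchIn j x F.< punchIn j y → x F.< y
punchIn-cancel-< j {x} {y} jx<jy =
  FP.≤∧≢⇒< (FP.punchIn-cancel-≤ j x y (<⇒≤ jx<jy)) (FP.<⇒≢ jx<jy ∘ cong (punchIn j))

module _ {A : Set} where

  countᵇ-cong : {p q : A → Bool} → p ≗ q → countᵇ p ≗ countᵇ q
  countᵇ-cong p≗q [] = refl
  countᵇ-cong p≗q (x ∷ xs) rewrite p≗q x | countᵇ-cong p≗q xs = refl

  countᵇ-++ : (p : A → Bool) (xs ys : List A) → countᵇ p (xs ++ ys) ≡ countᵇ p xs + countᵇ p ys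
  countᵇ-++ p [] ys = refl
  countᵇ-++ p (x ∷ xs) ys with p x
  ... | true = cong suc (countᵇ-++ p xs ys)
  ... | false = countᵇ-++ p xs ys

  countᵇ-≤-length : (p : A → Bool) (xs : List A) → countᵇ p xs ≤ length xs
  countᵇ-≤-length p [] = z≤n
  countᵇ-≤-length p (x ∷ xs) with p x
  ... | true = s≤s (countᵇ-≤-length p xs)
  ... | false = m≤n⇒m≤1+n (countᵇ-≤-length p xs)

  countᵇ-none : (p : A → Bool) → (∀ x → ¬ T (p x)) → (xs : List A) → countᵇ p xs ≡ 0
  countᵇ-none p none [] = refl
  countᵇ-none p none (x ∷ xs) with p x | none x
  ... | true | ¬px = ⊥-elim (¬px _)
  ... | false | _ = countᵇ-none p none xs

  countᵇ-pos : (p : A → Bool) {x : A} {xs : List A} → x ∈ xs → T (p x) → 0 < countᵇ p xs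
  countᵇ-pos p {xs = y ∷ ys} (here refl) px with p y
  ... | true = s≤s z≤n
  ... | false = ⊥-elim px
  countᵇ-pos p {xs = y ∷ ys} (there x∈ys) px with p y
  ... | true = s≤s z≤n
  ... | false = countᵇ-pos p x∈ys px

module _ {A B : Set} where

  countᵇ-map : (p : B → Bool) (g : A → B) (xs : List A) →
    countᵇ p (map g xs) ≡ countᵇ (p ∘ g) xs
  countᵇ-map p g [] = refl
  countᵇ-map p g (x ∷ xs) with p (g x)
  ... | true = cong suc (countᵇ-map p g xs)
  ... | false = countᵇ-map p g xs

  countᵇ-concatMap : (p : B → Bool) (h : A → List B) (xs : List A) →
    countᵇ p (concatMap h xs) ≡ sum (map (countᵇ p ∘ h) xs)
  countᵇ-concatMap p h [] = refl
  countᵇ-concatMap p h (x ∷ xs) =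
    trans (countᵇ-++ p (h x) (concatMap h xs)) (cong (countᵇ p (h x) +_) (countᵇ-concatMap p h xs))

countᵇ-allFin-suc : ∀ {k} (p : Fin (suc k) → Bool) →
  countᵇ p (allFin (suc k)) ≡ countᵇ p [ fzero ] + countᵇ (p ∘ fsuc) (allFin k)
countᵇ-allFin-suc {k} p = trans (countᵇ-++ p [ fzero ] (tabulate fsuc))
  (cong (countᵇ p [ fzero ] +_)
    (trans (cong (countᵇ p) (sym (map-tabulate id fsuc))) (countᵇ-map p fsuc (allFin k))))

countᵇ-allFin-≤1 : ∀ {k} (p : Fin k → Bool) → (∀ {x y} → T (p x) → T (p y) → x ≡ y) →
  countᵇ p (allFin k) ≤ 1
countᵇ-allFin-≤1 {zero} p unique = z≤n
countᵇ-allFin-≤1 {suc k} p unique rewrite countᵇ-allFin-suc p with p fzero in p0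
... | true = s≤s (≤-reflexive (countᵇ-none (p ∘ fsuc)
               (λ x px → FP.0≢1+n (unique (subst T (sym p0) _) px)) (allFin k)))
... | false = countᵇ-allFin-≤1 (p ∘ fsuc) (λ px py → FP.suc-injective (unique px py))

∑-ones : ∀ m → ∑[ c < m ] 1 ≡ m
∑-ones zero = refl
∑-ones (suc m) = cong suc (∑-ones m)

∑-countᵇ-≟ : ∀ {m} (ys : List (Fin m)) → ∑[ c < m ] countᵇ (λ y → ⌊ y F.≟ c ⌋) ys ≡ length ys
∑-countᵇ-≟ {m} [] = sum-replicate-zero m
∑-countᵇ-≟ {m} (y ∷ ys) = begin
    ∑[ c < m ] countᵇ (_== c) (y ∷ ys)
  ≡⟨ sum-cong-≗ (λ c → countᵇ-++ (_== c) [ y ] ys) ⟩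
    ∑[ c < m ] (countᵇ (_== c) [ y ] + countᵇ (_== c) ys)
  ≡⟨ ∑-distrib-+ (λ c → countᵇ (_== c) [ y ]) (λ c → countᵇ (_== c) ys) ⟩
    ∑[ c < m ] countᵇ (_== c) [ y ] + ∑[ c < m ] countᵇ (_== c) ys
  ≡⟨ cong₂ _+_ (∑-singleton y) (∑-countᵇ-≟ ys) ⟩
    suc (length ys)
  ∎
  where
  open ≡-Reasoning
  _==_ : ∀ {m} → Fin m → Fin m → Bool
  y == c = ⌊ y F.≟ c ⌋
  ∑-singleton : ∀ {m} (y : Fin m) → ∑[ c < m ] countᵇ (_== c) [ y ] ≡ 1
  ∑-singleton {suc m} fzero = cong suc (sum-replicate-zero m)
  ∑-singleton {suc m} (fsuc y) = trans
    (sum-cong-≗ (λ c → cong (λ b → if b then 1 else 0) (⌊⌋-map′ _ _ (y F.≟ c))))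
    (∑-singleton y)

-- Counting maps Fin n → Fin m

-- The maps in allFuns are assembled by consF, so they can only be compared pointwise.
Extensional : ∀ {n m} → ((Fin n → Fin m) → Bool) → Set
Extensional p = ∀ {f g} → f ≗ g → p f ≡ p g

consF-≗ : ∀ {n m} {c : Fin m} {f g : Fin n → Fin m} → f ≗ g → consF c f ≗ consF c g
consF-≗ f≗g fzero = refl
consF-≗ f≗g (fsuc i) = f≗g i

punchIn-consF : ∀ {n m} (j : Fin (suc m)) (c : Fin m) (g : Fin n → Fin m) →
  punchIn j ∘ consF c g ≗ consF (punchIn j c) (punchIn j ∘ g)
punchIn-consF j c g fzero = refl
punchIn-consF j c g (fsuc i) = refl

countᵇ-allFuns-suc : ∀ n {m} (p : (Fin (suc n) → Fin m) → Bool) →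
  countᵇ p (allFuns (suc n) m) ≡ ∑[ c < m ] countᵇ (p ∘ consF c) (allFuns n m)
countᵇ-allFuns-suc n {m} p = begin
    countᵇ p (concatMap (λ c → map (consF c) (allFuns n m)) (allFin m))
  ≡⟨ countᵇ-concatMap p _ (allFin m) ⟩
    sum (map (λ c → countᵇ p (map (consF c) (allFuns n m))) (allFin m))
  ≡⟨ cong sum (map-cong (λ c → countᵇ-map p (consF c) (allFuns n m)) (allFin m)) ⟩
    sum (map (λ c → countᵇ (p ∘ consF c) (allFuns n m)) (allFin m))
  ≡⟨ foldr-map-allFin _+_ 0 (λ c → countᵇ (p ∘ consF c) (allFuns n m)) ⟩
    ∑[ c < m ] countᵇ (p ∘ consF c) (allFuns n m)
  ∎
  where open ≡-Reasoning

countᵇ-allFuns-punchIn : ∀ n {m} (j : Fin (suc m)) (p : (Fin n → Fin (suc m)) → Bool) →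
  Extensional p → (∀ f → T (p f) → ∀ i → f i ≢ j) →
  countᵇ p (allFuns n (suc m)) ≡ countᵇ (λ f → p (punchIn j ∘ f)) (allFuns n m)
countᵇ-allFuns-punchIn zero j p ext avoids = cong (λ b → if b then 1 else 0) (ext (λ ()))
countᵇ-allFuns-punchIn (suc n) {m} j p ext avoids = begin
    countᵇ p (allFuns (suc n) (suc m))
  ≡⟨ countᵇ-allFuns-suc n p ⟩
    ∑[ c < suc m ] countᵇ (p ∘ consF c) (allFuns n (suc m))
  ≡⟨ sum-remove {i = j} (λ c → countᵇ (p ∘ consF c) (allFuns n (suc m))) ⟩
    countᵇ (p ∘ consF j) (allFuns n (suc m))
      + ∑[ c < m ] countᵇ (p ∘ consF (punchIn j c)) (allFuns n (suc m))
  ≡⟨ cong₂ _+_ (countᵇ-none (p ∘ consF j) (λ g pg → avoids _ pg fzero refl) (allFuns n (suc m)))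
               (sum-cong-≗ relabel) ⟩
    ∑[ c < m ] countᵇ (λ g → p (punchIn j ∘ consF c g)) (allFuns n m)
  ≡⟨ countᵇ-allFuns-suc n (λ f → p (punchIn j ∘ f)) ⟨
    countᵇ (λ f → p (punchIn j ∘ f)) (allFuns (suc n) m)
  ∎
  where
  open ≡-Reasoning
  relabel : ∀ c → countᵇ (p ∘ consF (punchIn j c)) (allFuns n (suc m))
                ≡ countᵇ (λ g → p (punchIn j ∘ consF c g)) (allFuns n m)
  relabel c = trans
    (countᵇ-allFuns-punchIn n j (p ∘ consF (punchIn j c)) (ext ∘ consF-≗)
      (λ f pf i → avoids _ pf (fsuc i)))
    (countᵇ-cong (λ g → ext (λ i → sym (punchIn-consF j c g i))) (allFuns n m))

multiplicity : ∀ {n m} → (Fin n → Fin m) → Fin m → ℕ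
multiplicity {n} f c = countᵇ (λ i → ⌊ f i F.≟ c ⌋) (allFin n)

multiplicity-≗ : ∀ {n m} {f g : Fin n → Fin m} → f ≗ g → multiplicity f ≗ multiplicity g
multiplicity-≗ {n} f≗g c = countᵇ-cong (λ i → cong (λ x → ⌊ x F.≟ c ⌋) (f≗g i)) (allFin n)

multiplicity-punchIn : ∀ {n m} (j : Fin (suc m)) (f : Fin n → Fin m) c →
  multiplicity (punchIn j ∘ f) (punchIn j c) ≡ multiplicity f c
multiplicity-punchIn {n} j f c =
  countᵇ-cong (λ i → ⌊⌋-⇔ (mk⇔ (FP.punchIn-injective j _ _) (cong (punchIn j))) _ _) (allFin n)

multiplicity-punchIn-hole : ∀ {n m} (j : Fin (suc m)) (f : Fin n → Fin m) →
  multiplicity (punchIn j ∘ f) j ≡ 0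
multiplicity-punchIn-hole {n} j f =
  countᵇ-none _ (λ i t → FP.punchInᵢ≢i j (f i) (toWitness t)) (allFin n)

∑-multiplicity : ∀ {n m} (f : Fin n → Fin m) → ∑[ c < m ] multiplicity f c ≡ n
∑-multiplicity {n} f = begin
    ∑[ c < _ ] countᵇ (λ i → ⌊ f i F.≟ c ⌋) (allFin n)
  ≡⟨ sum-cong-≗ (λ c → countᵇ-map (λ y → ⌊ y F.≟ c ⌋) f (allFin n)) ⟨
    ∑[ c < _ ] countᵇ (λ y → ⌊ y F.≟ c ⌋) (map f (allFin n))
  ≡⟨ ∑-countᵇ-≟ (map f (allFin n)) ⟩
    length (map f (allFin n))
  ≡⟨ trans (length-map f (allFin n)) (length-tabulate id) ⟩
    n
  ∎
  where open ≡-Reasoning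

multiplicity-≤1 : ∀ {n m} {f : Fin n → Fin m} → (∀ {i j} → f i ≡ f j → i ≡ j) →
  ∀ c → multiplicity f c ≤ 1
multiplicity-≤1 {f = f} f-injective c = countᵇ-allFin-≤1 (λ i → ⌊ f i F.≟ c ⌋)
  (λ ti tj → f-injective (trans (toWitness ti) (sym (toWitness tj))))

T-hasContent : ∀ {n m} {f : Fin n → Fin m} {α} →
  T (hasContent n f α) ⇔ (∀ c → multiplicity f c ≡ α c)
T-hasContent = mk⇔
  (λ t c → ≡ᵇ⇒≡ _ _ (Equivalence.to T-all-allFin t c))
  (λ h → Equivalence.from T-all-allFin (λ c → ≡⇒≡ᵇ _ _ (h c)))

hasContent-≗ : ∀ {n m} {f g : Fin n → Fin m} (α : Fin m → ℕ) → f ≗ g →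
  hasContent n f α ≡ hasContent n g α
hasContent-≗ {m = m} α f≗g =
  cong and (map-cong (λ c → cong (_≡ᵇ α c) (multiplicity-≗ f≗g c)) (allFin m))

hasContent-cong : ∀ {n m} (f : Fin n → Fin m) {α β : Fin m → ℕ} → α ≗ β →
  hasContent n f α ≡ hasContent n f β
hasContent-cong {m = m} f α≗β =
  cong and (map-cong (λ c → cong (multiplicity f c ≡ᵇ_) (α≗β c)) (allFin m))

hasContent-punchIn : ∀ {n m} (α : Fin (suc m) → ℕ) (j : Fin (suc m)) → α j ≡ 0 →
  (f : Fin n → Fin m) → hasContent n (punchIn j ∘ f) α ≡ hasContent n f (α ∘ punchIn j)
hasContent-punchIn {n} {m} α j αj≡0 f = begin
    all agrees (allFin (suc m))
  ≡⟨ foldr-map-allFin _∧_ true agrees ⟩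
    ⋀ agrees
  ≡⟨ ⋀-remove {i = j} agrees ⟩
    agrees j ∧ ⋀ (agrees ∘ punchIn j)
  ≡⟨ cong₂ (λ x y → (x ≡ᵇ y) ∧ ⋀ (agrees ∘ punchIn j)) (multiplicity-punchIn-hole j f) αj≡0 ⟩
    ⋀ (agrees ∘ punchIn j)
  ≡⟨ ⋀-cong-≗ (λ c → cong (_≡ᵇ α (punchIn j c)) (multiplicity-punchIn j f c)) ⟩
    ⋀ (λ c → multiplicity f c ≡ᵇ α (punchIn j c))
  ≡⟨ foldr-map-allFin _∧_ true (λ c → multiplicity f c ≡ᵇ α (punchIn j c)) ⟨
    hasContent n f (α ∘ punchIn j)
  ∎
  where
  open ≡-Reasoning
  agrees : Fin (suc m) → Bool
  agrees c = multiplicity (punchIn j ∘ f) c ≡ᵇ α c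

isElementaryContent : (n : ℕ) {m : ℕ} → (Fin m → ℕ) → Bool
isElementaryContent n {m} α = all (λ c → α c ≤ᵇ 1) (allFin m) ∧ (sum (map α (allFin m)) ≡ᵇ n)

isElementaryContent-intro : ∀ {n m} {α : Fin m → ℕ} → (∀ c → α c ≤ 1) → ∑[ c < m ] α c ≡ n →
  T (isElementaryContent n α)
isElementaryContent-intro {α = α} α≤1 ∑α≡n = Equivalence.from T-∧
  ( Equivalence.from T-all-allFin (λ c → ≤⇒≤ᵇ (α≤1 c))
  , ≡⇒≡ᵇ _ _ (trans (foldr-map-allFin _+_ 0 α) ∑α≡n))

isElementaryContent-elim : ∀ {n m} {α : Fin m → ℕ} → T (isElementaryContent n α) →
  (∀ c → α c ≤ 1) × ∑[ c < m ] α c ≡ n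
isElementaryContent-elim {α = α} t with Equivalence.to T-∧ t
... | t-≤1 , t-sum = (λ c → ≤ᵇ⇒≤ _ _ (Equivalence.to T-all-allFin t-≤1 c))
                   , trans (sym (foldr-map-allFin _+_ 0 α)) (≡ᵇ⇒≡ _ _ t-sum)

-- Cyclic shifts

[m%d+n]%d≡[m+n]%d : ∀ m n d .{{_ : NonZero d}} → (m % d + n) % d ≡ (m + n) % d
[m%d+n]%d≡[m+n]%d m n d = begin
    (m % d + n) % d            ≡⟨ %-distribˡ-+ (m % d) n d ⟩
    (m % d % d + n % d) % d    ≡⟨ cong (λ x → (x + n % d) % d) (m%n%n≡m%n m d) ⟩
    (m % d + n % d) % d        ≡⟨ %-distribˡ-+ m n d ⟨
    (m + n) % d                ∎
  where open ≡-Reasoning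

[m+n%d]%d≡[m+n]%d : ∀ m n d .{{_ : NonZero d}} → (m + n % d) % d ≡ (m + n) % d
[m+n%d]%d≡[m+n]%d m n d = begin
    (m + n % d) % d  ≡⟨ cong (_% d) (+-comm m (n % d)) ⟩
    (n % d + m) % d  ≡⟨ [m%d+n]%d≡[m+n]%d n m d ⟩
    (n + m) % d      ≡⟨ cong (_% d) (+-comm n m) ⟩
    (m + n) % d      ∎
  where open ≡-Reasoning

2*m≤n⊎2*[n∸m]≤n : ∀ m n → 2 * m ≤ n ⊎ 2 * (n ∸ m) ≤ n
2*m≤n⊎2*[n∸m]≤n m n with 2 * m ≤? n
... | yes 2m≤n = inj₁ 2m≤n
... | no 2m≰n = inj₂ (begin
    2 * (n ∸ m)    ≡⟨ *-distribˡ-∸ 2 n m ⟩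
    2 * n ∸ 2 * m  ≤⟨ m≤n+o⇒m∸n≤o (2 * n) (2 * m) 2n≤2m+n ⟩
    n              ∎)
  where
  open ≤-Reasoning
  2n≤2m+n : 2 * n ≤ 2 * m + n
  2n≤2m+n = ≤-trans (≤-reflexive (cong (n +_) (+-identityʳ n))) (+-monoˡ-≤ n (<⇒≤ (≰⇒> 2m≰n)))

module _ {n : ℕ} .{{_ : NonZero n}} where

  toℕ-shift : ∀ i d → toℕ (shift n i d) ≡ (toℕ i + d) % n
  toℕ-shift i d = FP.toℕ-fromℕ< _

  shift-+ : ∀ i d e → shift n (shift n i d) e ≡ shift n i (d + e)
  shift-+ i d e = FP.toℕ-injective (begin
      toℕ (shift n (shift n i d) e)  ≡⟨ toℕ-shift (shift n i d) e ⟩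
      (toℕ (shift n i d) + e) % n    ≡⟨ cong (λ x → (x + e) % n) (toℕ-shift i d) ⟩
      ((toℕ i + d) % n + e) % n      ≡⟨ [m%d+n]%d≡[m+n]%d (toℕ i + d) e n ⟩
      (toℕ i + d + e) % n            ≡⟨ cong (_% n) (+-assoc (toℕ i) d e) ⟩
      (toℕ i + (d + e)) % n          ≡⟨ toℕ-shift i (d + e) ⟨
      toℕ (shift n i (d + e))        ∎)
    where open ≡-Reasoning

  shift-0 : ∀ i → shift n i 0 ≡ i
  shift-0 i = FP.toℕ-injective (trans (toℕ-shift i 0)
    (trans (cong (_% n) (+-identityʳ (toℕ i))) (m<n⇒m%n≡m (FP.toℕ<n i))))

  shift-n : ∀ i → shift n i n ≡ i
  shift-n i = FP.toℕ-injective (trans (toℕ-shift i n)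
    (trans ([m+n]%n≡m%n (toℕ i) n) (m<n⇒m%n≡m (FP.toℕ<n i))))

  offset : ∀ i j → ∃ λ d → d < n × shift n i d ≡ j
  offset i j = d , m%n<n _ n , FP.toℕ-injective (begin
      toℕ (shift n i d)
    ≡⟨ toℕ-shift i d ⟩
      (toℕ i + d) % n
    ≡⟨ [m+n%d]%d≡[m+n]%d (toℕ i) (n ∸ toℕ i + toℕ j) n ⟩
      (toℕ i + (n ∸ toℕ i + toℕ j)) % n
    ≡⟨ cong (_% n) (+-assoc (toℕ i) (n ∸ toℕ i) (toℕ j)) ⟨
      (toℕ i + (n ∸ toℕ i) + toℕ j) % n
    ≡⟨ cong (λ x → (x + toℕ j) % n) (m+[n∸m]≡n (<⇒≤ (FP.toℕ<n i))) ⟩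
      (n + toℕ j) % n
    ≡⟨ trans (cong (_% n) (+-comm n (toℕ j))) ([m+n]%n≡m%n (toℕ j) n) ⟩
      toℕ j % n
    ≡⟨ m<n⇒m%n≡m (FP.toℕ<n j) ⟩
      toℕ j
    ∎)
    where
    open ≡-Reasoning
    d = (n ∸ toℕ i + toℕ j) % n

  offset-pos : ∀ {i j d} → shift n i d ≡ j → i ≢ j → 0 < d
  offset-pos {d = zero} i+0≡j i≢j = ⊥-elim (i≢j (trans (sym (shift-0 _)) i+0≡j))
  offset-pos {d = suc d} _ _ = s≤s z≤n

  shift-back : ∀ {i j d} → shift n i d ≡ j → d ≤ n → shift n j (n ∸ d) ≡ i
  shift-back {i} {j} {d} i+d≡j d≤n = begin
      shift n j (n ∸ d)              ≡⟨ cong (λ x → shift n x (n ∸ d)) i+d≡j ⟨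
      shift n (shift n i d) (n ∸ d)  ≡⟨ shift-+ i d (n ∸ d) ⟩
      shift n i (d + (n ∸ d))        ≡⟨ cong (shift n i) (m+[n∸m]≡n d≤n) ⟩
      shift n i n                    ≡⟨ shift-n i ⟩
      i                              ∎
    where open ≡-Reasoning

  ∈-edges : ∀ (a : Fin n → ℕ) i d → 0 < d → d ≤ a i → (i , shift n i d) ∈ edges n a
  ∈-edges a i (suc d) _ d<ai = ∈-concat⁺′
    (∈-map⁺ (λ d → (i , shift n i (suc d))) (∈-upTo⁺ d<ai))
    (∈-map⁺ (λ i → map (λ d → (i , shift n i (suc d))) (upTo (a i))) (∈-allFin i))

  circArea-decay : ∀ {a} → CircArea n a → ∀ i k → a i ∸ k ≤ a (shift n i k)
  circArea-decay {a} circ i zero = ≤-reflexive (cong a (sym (shift-0 i)))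
  circArea-decay {a} circ i (suc k) = begin
      a i ∸ suc k
    ≡⟨ pred[m∸n]≡m∸[1+n] (a i) k ⟨
      pred (a i ∸ k)
    ≤⟨ pred-mono-≤ (≤-trans (circArea-decay circ i k) (proj₂ (circ (shift n i k)))) ⟩
      a (shift n (shift n i k) 1)
    ≡⟨ cong a (trans (shift-+ i k 1) (cong (shift n i) (+-comm k 1))) ⟩
      a (shift n i (suc k))
    ∎
    where open ≤-Reasoning

-- Proper colourings of Γ_a

Complete : (n : ℕ) .{{_ : NonZero n}} → (Fin n → ℕ) → Set
Complete n a = ∀ i j → i ≢ j → (i , j) ∈ edges n a ⊎ (j , i) ∈ edges n a

module _ {n : ℕ} .{{_ : NonZero n}} {a : Fin n → ℕ} where

  complete-if-half : (∀ i → n ≤ 2 * a i) → Complete n a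
  complete-if-half half i j i≢j with offset i j
  ... | d , d<n , i+d≡j with 2*m≤n⊎2*[n∸m]≤n d n
  ...   | inj₁ 2d≤n = inj₁ (subst (λ x → (i , x) ∈ edges n a) i+d≡j
            (∈-edges a i d (offset-pos i+d≡j i≢j) (*-cancelˡ-≤ 2 (≤-trans 2d≤n (half i)))))
  ...   | inj₂ 2[n∸d]≤n = inj₂ (subst (λ x → (j , x) ∈ edges n a) (shift-back i+d≡j (<⇒≤ d<n))
            (∈-edges a j (n ∸ d) (m<n⇒0<n∸m d<n) (*-cancelˡ-≤ 2 (≤-trans 2[n∸d]≤n (half j)))))

  module _ (circ : CircArea n a) {i₀ : Fin n} (full : a i₀ ≡ n ∸ 1) where

    ∈-edges-from-full : ∀ {k l} → k < l → l < n → (shift n i₀ k , shift n i₀ l) ∈ edges n a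
    ∈-edges-from-full {k} {l} k<l l<n = subst (λ x → (shift n i₀ k , x) ∈ edges n a)
      (trans (shift-+ i₀ k (l ∸ k)) (cong (shift n i₀) (m+[n∸m]≡n (<⇒≤ k<l))))
      (∈-edges a _ (l ∸ k) (m<n⇒0<n∸m k<l) (begin
        l ∸ k             ≤⟨ ∸-monoˡ-≤ k (<⇒≤pred l<n) ⟩
        pred n ∸ k        ≡⟨ cong (_∸ k) (trans (pred[m∸n]≡m∸[1+n] n 0) (sym full)) ⟩
        a i₀ ∸ k          ≤⟨ circArea-decay circ i₀ k ⟩
        a (shift n i₀ k)  ∎))
      where open ≤-Reasoning

    complete-if-full : Complete n a
    complete-if-full i j i≢j with offset i₀ i | offset i₀ j
    ... | k , k<n , refl | l , l<n , refl with <-cmp k l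
    ...   | tri< k<l _ _ = inj₁ (∈-edges-from-full k<l l<n)
    ...   | tri≈ _ refl _ = ⊥-elim (i≢j refl)
    ...   | tri> _ _ l<k = inj₂ (∈-edges-from-full l<k k<n)

  proper⇒≢ : ∀ {m} {f : Fin n → Fin m} → T (proper n a f) →
    ∀ {i j} → (i , j) ∈ edges n a → f i ≢ f j
  proper⇒≢ t i→j = toWitnessFalse (All.lookup (all⁺ _ (edges n a) t) i→j)

  proper⇒injective : Complete n a → ∀ {m} {f : Fin n → Fin m} → T (proper n a f) →
    ∀ {i j} → f i ≡ f j → i ≡ j
  proper⇒injective complete t {i} {j} fi≡fj with i FP.≟ j
  ... | yes i≡j = i≡j
  ... | no i≢j with complete i j i≢j
  ...   | inj₁ i→j = ⊥-elim (proper⇒≢ t i→j fi≡fj)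
  ...   | inj₂ j→i = ⊥-elim (proper⇒≢ t j→i (sym fi≡fj))

  proper-≗ : ∀ {m} {f g : Fin n → Fin m} → f ≗ g → proper n a f ≡ proper n a g
  proper-≗ f≗g = cong and (map-cong
    (λ { (i , j) → cong₂ (λ x y → not ⌊ x F.≟ y ⌋) (f≗g i) (f≗g j) }) (edges n a))

  proper-punchIn : ∀ {m} (j : Fin (suc m)) (f : Fin n → Fin m) →
    proper n a (punchIn j ∘ f) ≡ proper n a f
  proper-punchIn j f = cong and (map-cong
    (λ { (i , i′) → cong not (⌊⌋-⇔ (mk⇔ (FP.punchIn-injective j _ _) (cong (punchIn j))) _ _) })
    (edges n a))

  asc-≗ : ∀ {m} {f g : Fin n → Fin m} → f ≗ g → asc n a f ≡ asc n a g
  asc-≗ f≗g = countᵇ-cong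
    (λ { (i , j) → cong₂ (λ x y → ⌊ x F.<? y ⌋) (f≗g i) (f≗g j) }) (edges n a)

  asc-punchIn : ∀ {m} (j : Fin (suc m)) (f : Fin n → Fin m) → asc n a (punchIn j ∘ f) ≡ asc n a f
  asc-punchIn j f = countᵇ-cong
    (λ { (i , i′) → ⌊⌋-⇔ (mk⇔ (punchIn-cancel-< j) (punchIn-mono-< j)) _ _ }) (edges n a)

  contributes : ∀ {m} → (Fin m → ℕ) → ℕ → (Fin n → Fin m) → Bool
  contributes α k f = proper n a f ∧ hasContent n f α ∧ (asc n a f ≡ᵇ k)

  contributes-elim : ∀ {m} {α : Fin m → ℕ} {k f} → T (contributes α k f) →
    T (proper n a f) × (∀ c → multiplicity f c ≡ α c) × asc n a f ≡ k
  contributes-elim {f = f} t with Equivalence.to T-∧ t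
  ... | t-proper , t-rest with Equivalence.to T-∧ t-rest
  ...   | t-content , t-asc =
    t-proper , Equivalence.to (T-hasContent {f = f}) t-content , ≡ᵇ⇒≡ _ _ t-asc

  contributes-≗ : ∀ {m} (α : Fin m → ℕ) k → Extensional (contributes α k)
  contributes-≗ α k f≗g =
    cong₂ _∧_ (proper-≗ f≗g) (cong₂ _∧_ (hasContent-≗ α f≗g) (cong (_≡ᵇ k) (asc-≗ f≗g)))

  contributes-punchIn : ∀ {m} (α : Fin (suc m) → ℕ) (j : Fin (suc m)) → α j ≡ 0 →
    ∀ k (f : Fin n → Fin m) → contributes α k (punchIn j ∘ f) ≡ contributes (α ∘ punchIn j) k f
  contributes-punchIn α j αj≡0 k f = cong₂ _∧_ (proper-punchIn j f)
    (cong₂ _∧_ (hasContent-punchIn α j αj≡0 f) (cong (_≡ᵇ k) (asc-punchIn j f)))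

  contributes⇒isElementaryContent : Complete n a → ∀ {m} {α : Fin m → ℕ} {k f} →
    T (contributes α k f) → T (isElementaryContent n α)
  contributes⇒isElementaryContent complete {f = f} t with contributes-elim t
  ... | t-proper , content , _ = isElementaryContent-intro
    (λ c → subst (_≤ 1) (content c) (multiplicity-≤1 (proper⇒injective complete t-proper) c))
    (trans (sym (sum-cong-≗ content)) (∑-multiplicity f))

  -- Coefficients of X_a

  coeffX-cong : ∀ {m} {α β : Fin m → ℕ} → α ≗ β → ∀ k → coeffX n a m α k ≡ coeffX n a m β k
  coeffX-cong {m} α≗β k = countᵇ-cong
    (λ f → cong (λ b → proper n a f ∧ b ∧ (asc n a f ≡ᵇ k)) (hasContent-cong f α≗β)) (allFuns n m)

  coeffX-vanishes : ∀ {m} (α : Fin m → ℕ) k → length (edges n a) < k → coeffX n a m α k ≡ 0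
  coeffX-vanishes {m} α k len<k = countᵇ-none (contributes α k) too-many-ascents (allFuns n m)
    where
    too-many-ascents : ∀ f → ¬ T (contributes α k f)
    too-many-ascents f t with contributes-elim t
    ... | _ , _ , asc≡k =
      <⇒≱ len<k (subst (_≤ length (edges n a)) asc≡k (countᵇ-≤-length _ (edges n a)))

  coeffX-punchIn : ∀ {m} (α : Fin (suc m) → ℕ) (j : Fin (suc m)) → α j ≡ 0 → ∀ k →
    coeffX n a (suc m) α k ≡ coeffX n a m (α ∘ punchIn j) k
  coeffX-punchIn {m} α j αj≡0 k = trans
    (countᵇ-allFuns-punchIn n j (contributes α k) (contributes-≗ α k) avoids-j)
    (countᵇ-cong (contributes-punchIn α j αj≡0 k) (allFuns n m))
    where
    avoids-j : ∀ f → T (contributes α k f) → ∀ i → f i ≢ j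
    avoids-j f t i fi≡j with contributes-elim t
    ... | _ , content , _ =
      <-irrefl (sym (trans (content j) αj≡0)) (countᵇ-pos _ (∈-allFin i) (fromWitness fi≡j))

  coeffX-allOnes : ∀ {m} (α : Fin m → ℕ) → (∀ c → α c ≡ 1) → ∑[ c < m ] α c ≡ n → ∀ k →
    coeffX n a m α k ≡ coeffX n a n (λ _ → 1) k
  coeffX-allOnes {m} α ones ∑α≡n k
    with refl ← trans (sym (trans (sum-cong-≗ ones) (∑-ones m))) ∑α≡n = coeffX-cong ones k

  coeffX-squarefree : ∀ {m} (α : Fin m → ℕ) → (∀ c → α c ≤ 1) → ∑[ c < m ] α c ≡ n → ∀ k →
    coeffX n a m α k ≡ coeffX n a n (λ _ → 1) k
  coeffX-squarefree α α≤1 ∑α≡n k with FP.any? (λ c → α c ≟ 0)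
  coeffX-squarefree {suc m} α α≤1 ∑α≡n k | yes (j , αj≡0) = trans
    (coeffX-punchIn α j αj≡0 k)
    (coeffX-squarefree (α ∘ punchIn j) (α≤1 ∘ punchIn j) ∑α∘punchIn≡n k)
    where
    ∑α∘punchIn≡n : ∑[ c < m ] α (punchIn j c) ≡ n
    ∑α∘punchIn≡n = trans (cong (_+ ∑[ c < m ] α (punchIn j c)) (sym αj≡0))
                         (trans (sym (sum-remove α)) ∑α≡n)
  ... | no no-zero = coeffX-allOnes α ones ∑α≡n k
    where
    ones : ∀ c → α c ≡ 1
    ones c with n≤1⇒n≡0∨n≡1 (α≤1 c)
    ... | inj₁ αc≡0 = ⊥-elim (no-zero (c , αc≡0))
    ... | inj₂ αc≡1 = αc≡1

  coeffX-complete : Complete n a → ∀ m (α : Fin m → ℕ) k →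
    coeffX n a m α k ≡ coeffE n m α * coeffX n a n (λ _ → 1) k
  coeffX-complete complete m α k with isElementaryContent n α in elementary
  ... | true = let α≤1 , ∑α≡n = isElementaryContent-elim (subst T (sym elementary) _)
               in trans (coeffX-squarefree α α≤1 ∑α≡n k) (sym (+-identityʳ _))
  ... | false = countᵇ-none (contributes α k)
    (λ f t → subst T elementary (contributes⇒isElementaryContent complete t)) (allFuns n m)

coeff-applyUpTo : ∀ (g : ℕ → ℕ) N k → (∀ k → N ≤ k → g k ≡ 0) → coeff (applyUpTo g N) k ≡ g k
coeff-applyUpTo g zero k vanish = sym (vanish k z≤n)
coeff-applyUpTo g (suc N) zero vanish = refl
coeff-applyUpTo g (suc N) (suc k) vanish =
  coeff-applyUpTo (g ∘ suc) N k (λ k → vanish (suc k) ∘ s≤s)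

mainTheorem10 : (n : ℕ) .{{_ : NonZero n}} (a : Fin n → ℕ) → CircArea n a
    → ((∀ i → n ≤ 2 * a i) ⊎ (∃ λ i → a i ≡ n ∸ 1))
    → ∃ λ (C : List ℕ) → ∀ (m : ℕ) (α : Fin m → ℕ) (k : ℕ)
      → coeffX n a m α k ≡ coeffE n m α * coeff C k
mainTheorem10 n a circ hyp = applyUpTo c N , λ m α k → begin
    coeffX n a m α k                 ≡⟨ coeffX-complete complete m α k ⟩
    coeffE n m α * c k               ≡⟨ cong (coeffE n m α *_) (coeff-applyUpTo c N k vanish) ⟨
    coeffE n m α * coeff (applyUpTo c N) k  ∎
  where
  open ≡-Reasoning
  c : ℕ → ℕ
  c = coeffX n a n (λ _ → 1)
  N : ℕ
  N = suc (length (edges n a))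
  vanish : ∀ k → N ≤ k → c k ≡ 0
  vanish = coeffX-vanishes (λ _ → 1)
  complete : Complete n a
  complete = [ complete-if-half , (λ (_ , full) → complete-if-full circ full) ]′ hyp
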